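{- Let $J=\{j_1,\ldots,j_k\}\subset\mathbb{Z}^+$ with $1\le j_1<\cdots<j_k$, and let $n$ be an integer such that $J\subset\{1,\ldots,\lfloor n/2\rfloor\}$ and $\mathrm{Ci}_n(J)$ is connected. Define the divisor $D$ on $\mathrm{Ci}_n(J)$ by \[D(v_\alpha)=\begin{cases}\sum_{i=1}^k\max\{0,\ j_i-|j_k-\alpha|\}, & \alpha\in[1,2j_k-1],\\[0.5em] \sum_{i=1}^k\max\{0,\ j_i-|j_k-(n-\alpha+1)|\}, & \alpha\in[n-2j_k+1,n]\setminus[1,2j_k-1],\\[0.5em] 0,&\text{otherwise.}\end{cases}\] Then $D$ has positive rank.
   Context: The circulant graph $\mathrm{Ci}_n(J)$ (for $J\subset\{1,\ldots,\lfloor n/2\rfloor\}$) has vertices $v_1,\ldots,v_n$, with $v_i$ adjacent to $v_m$ if and only if $|i-m|\bmod n\in J$. A divisor on a graph $G$ is a function $D:V(G)\to\mathbb{Z}$; it is effective if $D(v)\ge0$ for all $v$. Firing a vertex $v$ moves one chip from $v$ along each edge incident to $v$; two divisors are equivalent if related by a sequence of firings. $D$ has positive rank if for every vertex $q$, the divisor $D-q$ (remove one chip from $q$) is equivalent to an effective divisor. -}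

module Defs where

open import Data.Nat as ℕ using (ℕ; zero; suc; _∸_; _⊓_; _≡ᵇ_; _≤ᵇ_; ∣_-_∣)
open import Data.Integer as ℤ using (ℤ; +_; _-_; _+_; _≥_)
open import Data.Fin using (Fin; toℕ; _≟_)
open import Data.List using (List; filter; length; allFin)
open import Data.Bool.ListAction using (any)
open import Data.Bool using (Bool; true; false; if_then_else_; T; _∧_; not)
open import Data.Product using (Σ; ∃; _×_; _,_)
open import Relation.Nullary using (does)
open import Relation.Nullary.Decidable using (T?)
open import Relation.Binary.PropositionalEquality using (_≡_)
open import Relation.Binary.Construct.Closure.ReflexiveTransitive using (Star)
open import Data.Nat.ListAction using (sum)

-- Vertex v_α of Ci_n(J) is represented by i : Fin n with α = toℕ i + 1.
-- J = {j 0 < ... < j k'} is given by a function j : Fin (suc k') → ℕ.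

circDist : (n : ℕ) → Fin n → Fin n → ℕ
circDist n i m = ∣ toℕ i - toℕ m ∣ ⊓ (n ∸ ∣ toℕ i - toℕ m ∣)

adjᵇ : (n : ℕ) {k' : ℕ} (j : Fin (suc k') → ℕ) → Fin n → Fin n → Bool
adjᵇ n j u v = any (λ a → circDist n u v ≡ᵇ j a) (allFin _)

Adj : (n : ℕ) {k' : ℕ} (j : Fin (suc k') → ℕ) → Fin n → Fin n → Set
Adj n j u v = T (adjᵇ n j u v)

Connected : (n : ℕ) {k' : ℕ} (j : Fin (suc k') → ℕ) → Set
Connected n j = ∀ u v → Star (Adj n j) u v

degree : (n : ℕ) {k' : ℕ} (j : Fin (suc k') → ℕ) → Fin n → ℕ
degree n j v = length (filter (λ w → T? (adjᵇ n j v w)) (allFin n))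

Divisor : ℕ → Set
Divisor n = Fin n → ℤ

Effective : {n : ℕ} → Divisor n → Set
Effective D = ∀ w → D w ≥ + 0

fire : (n : ℕ) {k' : ℕ} (j : Fin (suc k') → ℕ) → Fin n → Divisor n → Divisor n
fire n j v D w =
  if does (w ≟ v) then D w - + degree n j v
  else (if adjᵇ n j v w then D w + + 1 else D w)

FireStep : (n : ℕ) {k' : ℕ} (j : Fin (suc k') → ℕ) → Divisor n → Divisor n → Set
FireStep n j D D' = ∃ λ v → ∀ w → D' w ≡ fire n j v D w

Equiv : (n : ℕ) {k' : ℕ} (j : Fin (suc k') → ℕ) → Divisor n → Divisor n → Set
Equiv n j = Star (FireStep n j)

minusPt : {n : ℕ} → Divisor n → Fin n → Divisor n
minusPt D q w = if does (w ≟ q) then D w - + 1 else D w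

PositiveRank : (n : ℕ) {k' : ℕ} (j : Fin (suc k') → ℕ) → Divisor n → Set
PositiveRank n j D = ∀ q → ∃ λ E → Effective E × Equiv n j (minusPt D q) E

inFirst : (jk α : ℕ) → Bool
inFirst jk α = (1 ≤ᵇ α) ∧ (α ≤ᵇ 2 ℕ.* jk ∸ 1)

inSecond : (n jk α : ℕ) → Bool
inSecond n jk α = ((n ∸ 2 ℕ.* jk) ℕ.+ 1 ≤ᵇ α) ∧ (α ≤ᵇ n)

bump : {k' : ℕ} (j : Fin (suc k') → ℕ) (jk β : ℕ) → ℕ
bump j jk β = sum (Data.List.map (λ a → j a ∸ ∣ jk - β ∣) (allFin _))

theDivisor : (n : ℕ) {k' : ℕ} (j : Fin (suc k') → ℕ) (jk : ℕ) → Divisor n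
theDivisor n j jk i = let α = toℕ i ℕ.+ 1 in
          if inFirst jk α then + bump j jk α
          else (if inSecond n jk α then + bump j jk (n ∸ α ℕ.+ 1) else + 0)

{-# OPTIONS --safe #-}
-- Index the vertex v_α by x = α - 1 and let K = j_k.  D consists of two tents
-- bump j c x = Σ_a (j_a ∸ ∣c - x∣), centred at c = K - 1 and c = n - K.  If D(q) > 0
-- there is nothing to fire.  Otherwise the supports of the tents are disjoint, q lies
-- between them, and D is exactly the sum of the two tents.  Firing the vertices outside
-- the gap (c₁, c₂] turns the tents centred at c₁ and c₂ + 1 into tents centred at
-- c₁ + 1 and c₂: for each j_a, the chips x gains, [x + j_a fired] + [x - j_a fired]
-- - 2 [x fired], are exactly the change of the two tents at x (tent-shift), and as long
-- as no tent reaches past 0 or n the neighbours x ± j_a (mod n) are fired exactly when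
-- x ± j_a are.  Moving the tents inwards puts one of them on q, which then carries at
-- least j_k chips.

module Submission where

open import Defs
open import Data.Nat using (ℕ; suc; _≤_; _<_; _*_)
open import Data.Fin using (Fin; fromℕ)
open import Data.Fin.Base using () renaming (_<_ to _<ᶠ_)

open import Data.Bool using (Bool; true; false; T; _∧_; _∨_; if_then_else_)
open import Data.Bool.Properties using (∨-zeroʳ; ∧-identityʳ; if-cong; if-cong₂; if-cong-then)
open import Data.Bool.ListAction using (any)
open import Data.Empty using (⊥; ⊥-elim)
open import Data.Fin using (zero; suc; toℕ; _≟_)
import Data.Fin.Properties as Fin
open import Data.List using (List; []; _∷_; map; filter; length; tabulate; allFin)
open import Data.Nat
  using (zero; _+_; _∸_; _⊓_; ∣_-_∣; _≤ᵇ_; _<ᵇ_; _≡ᵇ_; z≤n; s≤s; s≤s⁻¹; _≤?_; _<?_)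
open import Data.Nat.Properties hiding (_≟_)
open import Data.Nat.Properties using () renaming (_≟_ to _≟ℕ_)
open import Data.Nat.Tactic.RingSolver as ℕ-Solver using ()
open import Algebra.Properties.CommutativeSemigroup +-commutativeSemigroup using (interchange; xy∙z≈xz∙y)
open import Data.Integer as ℤ using (ℤ; +_)
import Data.Integer.Properties as ℤ
open import Data.Integer.Tactic.RingSolver as ℤ-Solver using ()
open import Algebra.Properties.AbelianGroup ℤ.+-0-abelianGroup using (∙-cancelʳ)
import Data.Nat.ListAction as List
open import Algebra.Properties.Semiring.Sum +-*-semiring
  using (sum-syntax; sum-cong-≗; sum-replicate-zero; ∑-distrib-+; ∑-comm; *-distribˡ-sum; *-distribʳ-sum)
open import Data.Product using (∃; ∃₂; _×_; _,_)
open import Data.Sum using (_⊎_; inj₁; inj₂; [_,_])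
import Data.Sum as Sum
open import Data.Unit using (tt)
open import Function using (_∘_; _⇔_; mk⇔; Equivalence)
open import Function.Construct.Composition using (_⇔-∘_)
open import Relation.Nullary using (¬_; Dec; yes; no; does)
open import Relation.Nullary.Decidable using (T?; dec-true; dec-false; does-⇔; _⊎-dec_)
open import Relation.Binary.Definitions using (tri<; tri≈; tri>)
open import Relation.Binary.PropositionalEquality
  using (_≡_; _≢_; refl; sym; trans; cong; cong₂; subst; subst₂; _≗_; module ≡-Reasoning)
open import Relation.Binary.Construct.Closure.ReflexiveTransitive using (ε; _◅_; _◅◅_; gmap)

-- Indicators and finite sums

χ : Bool → ℕ
χ true  = 1
χ false = 0

χ-∨-disjoint : ∀ a b → ¬ (T a × T b) → χ (a ∨ b) ≡ χ a + χ b
χ-∨-disjoint true  true  ¬ab = ⊥-elim (¬ab (tt , tt))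
χ-∨-disjoint true  false _   = refl
χ-∨-disjoint false b     _   = refl

χ-≤ᵇ-true : ∀ {m n} → m ≤ n → χ (m ≤ᵇ n) ≡ 1
χ-≤ᵇ-true {m} {n} m≤n = cong χ (dec-true (m ≤? n) m≤n)

χ-≤ᵇ-false : ∀ {m n} → n < m → χ (m ≤ᵇ n) ≡ 0
χ-≤ᵇ-false {m} {n} n<m = cong χ (dec-false (m ≤? n) (<⇒≱ n<m))

χ-<ᵇ+χ-≤ᵇ : ∀ m n → χ (m <ᵇ n) + χ (n ≤ᵇ m) ≡ 1
χ-<ᵇ+χ-≤ᵇ m n with m <? n
... | yes m<n = cong₂ _+_ (χ-≤ᵇ-true m<n) (χ-≤ᵇ-false m<n)
... | no  m≮n = cong₂ _+_ (χ-≤ᵇ-false (s≤s (≮⇒≥ m≮n))) (χ-≤ᵇ-true (≮⇒≥ m≮n))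

χ-+-≤ᵇ : ∀ x m n → χ (x + m ≤ᵇ x + n) ≡ χ (m ≤ᵇ n)
χ-+-≤ᵇ x m n = cong χ (does-⇔ (mk⇔ (+-cancelˡ-≤ x m n) (+-monoʳ-≤ x)) (x + m ≤? x + n) (m ≤? n))

χ-+-<ᵇ : ∀ x m n → χ (x + m <ᵇ x + n) ≡ χ (m <ᵇ n)
χ-+-<ᵇ x m n = cong χ (does-⇔ (mk⇔ (+-cancelˡ-< x m n) (+-monoʳ-< x)) (x + m <? x + n) (m <? n))

≡ᵇ-zero-pos : ∀ {m} → 1 ≤ m → (0 ≡ᵇ m) ≡ false
≡ᵇ-zero-pos {suc m} _ = refl

∑-zero : ∀ {m} (f : Fin m → ℕ) → (∀ i → f i ≡ 0) → ∑[ i < m ] f i ≡ 0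
∑-zero {m} f f≡0 = trans (sum-cong-≗ f≡0) (sum-replicate-zero m)

∑-distrib-+₃ : ∀ {m} (f g h : Fin m → ℕ) →
  ∑[ i < m ] (f i + g i + h i) ≡ ∑[ i < m ] f i + ∑[ i < m ] g i + ∑[ i < m ] h i
∑-distrib-+₃ f g h =
  trans (∑-distrib-+ (λ i → f i + g i) h) (cong (_+ ∑[ i < _ ] h i) (∑-distrib-+ f g))

term≤∑ : ∀ {m} (f : Fin m → ℕ) i → f i ≤ ∑[ k < m ] f k
term≤∑ f zero    = m≤m+n (f zero) _
term≤∑ f (suc i) = ≤-trans (term≤∑ (f ∘ suc) i) (m≤n+m _ (f zero))

∑-indicator-≟ : ∀ {m} (w : Fin m) (f : Fin m → ℕ) → ∑[ v < m ] (χ (does (w ≟ v)) * f v) ≡ f w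
∑-indicator-≟ {suc m} zero    f =
  trans (cong₂ _+_ (+-identityʳ (f zero)) (sum-replicate-zero m)) (+-identityʳ (f zero))
∑-indicator-≟ {suc m} (suc w) f = ∑-indicator-≟ w (f ∘ suc)

∑-indicator-toℕ : ∀ {m u} (f : ℕ → ℕ) → u < m → ∑[ v < m ] (χ (toℕ v ≡ᵇ u) * f (toℕ v)) ≡ f u
∑-indicator-toℕ {suc m} {zero}  f _ =
  trans (cong₂ _+_ (+-identityʳ (f 0)) (sum-replicate-zero m)) (+-identityʳ (f 0))
∑-indicator-toℕ {suc m} {suc u} f (s≤s u<m) = ∑-indicator-toℕ (f ∘ suc) u<m

sum-map-tabulate : ∀ {A : Set} {m} (f : A → ℕ) (g : Fin m → A) →
  List.sum (map f (tabulate g)) ≡ ∑[ i < m ] f (g i)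
sum-map-tabulate {m = zero}  f g = refl
sum-map-tabulate {m = suc m} f g = cong (λ s → f (g zero) + s) (sum-map-tabulate f (g ∘ suc))

sum-map-allFin : ∀ {m} (f : Fin m → ℕ) → List.sum (map f (allFin m)) ≡ ∑[ i < m ] f i
sum-map-allFin f = sum-map-tabulate f (λ i → i)

length-filter-χ : ∀ {A : Set} (p : A → Bool) xs →
  length (filter (T? ∘ p) xs) ≡ List.sum (map (χ ∘ p) xs)
length-filter-χ p []       = refl
length-filter-χ p (x ∷ xs) with p x
... | true  = cong suc (length-filter-χ p xs)
... | false = length-filter-χ p xs

sum-map-χ-filter : ∀ {A : Set} (p s : A → Bool) xs →
  List.sum (map (χ ∘ p) (filter (T? ∘ s) xs)) ≡ List.sum (map (λ x → χ (p x) * χ (s x)) xs)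
sum-map-χ-filter p s []       = refl
sum-map-χ-filter p s (x ∷ xs) with s x
... | true  = cong₂ _+_ (sym (*-identityʳ (χ (p x)))) (sum-map-χ-filter p s xs)
... | false = trans (sum-map-χ-filter p s xs)
  (cong (_+ List.sum (map (λ x → χ (p x) * χ (s x)) xs)) (sym (*-zeroʳ (χ (p x)))))

χ-any-tabulate : ∀ {A : Set} {m} (q : A → Bool) (g : Fin m → A) →
  (∀ a b → T (q (g a)) → T (q (g b)) → a ≡ b) →
  χ (any q (tabulate g)) ≡ ∑[ a < m ] χ (q (g a))
χ-any-tabulate {m = zero}  q g unique = refl
χ-any-tabulate {m = suc m} q g unique with q (g zero) in eq
... | true  = sym (cong suc (∑-zero _ others-false))
  where
  others-false : ∀ a → χ (q (g (suc a))) ≡ 0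
  others-false a with q (g (suc a)) in eq′
  ... | true  with () ← unique zero (suc a) (subst T (sym eq) tt) (subst T (sym eq′) tt)
  ... | false = refl
... | false = χ-any-tabulate q (g ∘ suc) (λ a b qa qb → Fin.suc-injective (unique (suc a) (suc b) qa qb))

-- Arithmetic of truncated subtraction and distance

∸≤⇔ : ∀ m n o → m ∸ n ≤ o ⇔ m ≤ n + o
∸≤⇔ m n o = mk⇔ (λ le → ≤-trans (m≤n+m∸n m n) (+-monoʳ-≤ n le)) (m≤n+o⇒m∸n≤o m n)

+-∸-+ : ∀ {n d} a → d ≤ n → a + (n ∸ d) + d ≡ a + n
+-∸-+ {n} {d} a d≤n = trans (+-assoc a (n ∸ d) d) (cong (λ e → a + e) (m∸n+n≡m d≤n))

+-∸-≡⇔ : ∀ {n d a b} → d ≤ n → a + (n ∸ d) ≡ b ⇔ b + d ≡ a + n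
+-∸-≡⇔ {n} {d} {a} d≤n = mk⇔
  (λ p → trans (cong (_+ d) (sym p)) (+-∸-+ a d≤n))
  (λ q → +-cancelʳ-≡ d _ _ (trans (+-∸-+ a d≤n) (sym q)))

∣m+n-m∣≡n : ∀ m n → ∣ m + n - m ∣ ≡ n
∣m+n-m∣≡n m n = trans (∣-∣-comm (m + n) m) (∣m-m+n∣≡n m n)

∣-∣≡⇔ : ∀ {x y e} → ∣ y - x ∣ ≡ e ⇔ (x + e ≡ y ⊎ y + e ≡ x)
∣-∣≡⇔ {x} {y} {e} = mk⇔ to from
  where
  to : ∣ y - x ∣ ≡ e → x + e ≡ y ⊎ y + e ≡ x
  to refl with ≤-total x y
  ... | inj₁ x≤y = inj₁ (trans (cong (λ e → x + e) (m≤n⇒∣n-m∣≡n∸m x≤y)) (m+[n∸m]≡n x≤y))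
  ... | inj₂ y≤x = inj₂ (trans (cong (λ e → y + e) (m≤n⇒∣m-n∣≡n∸m y≤x)) (m+[n∸m]≡n y≤x))
  from : x + e ≡ y ⊎ y + e ≡ x → ∣ y - x ∣ ≡ e
  from (inj₁ refl) = trans (∣-∣-comm (x + e) x) (∣m-m+n∣≡n x e)
  from (inj₂ refl) = ∣m-m+n∣≡n y e

∣-∣≤ : ∀ {c x r} → x ≤ c + r → c ≤ x + r → ∣ c - x ∣ ≤ r
∣-∣≤ {c} {x} {r} x≤c+r c≤x+r with ≤-total c x
... | inj₁ c≤x = subst (_≤ r) (sym (m≤n⇒∣m-n∣≡n∸m c≤x)) (m≤n+o⇒m∸n≤o x c x≤c+r)
... | inj₂ x≤c = subst (_≤ r) (sym (m≤n⇒∣n-m∣≡n∸m x≤c)) (m≤n+o⇒m∸n≤o c x c≤x+r)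

≤∣-∣ˡ : ∀ {c x K} → c + K ≤ x → K ≤ ∣ c - x ∣
≤∣-∣ˡ {c} {x} {K} c+K≤x = ≤-trans (m+n≤o⇒m≤o∸n K (subst (_≤ x) (+-comm c K) c+K≤x))
  (subst (x ∸ c ≤_) (∣-∣-comm x c) (m∸n≤∣m-n∣ x c))

≤∣-∣ʳ : ∀ {c x K} → x + K ≤ c → K ≤ ∣ c - x ∣
≤∣-∣ʳ {c} {x} {K} x+K≤c =
  ≤-trans (m+n≤o⇒m≤o∸n K (subst (_≤ c) (+-comm x K) x+K≤c)) (m∸n≤∣m-n∣ c x)

∣-∣-mirror : ∀ {x β K c n} → x + β ≡ n → K + c ≡ n → ∣ K - β ∣ ≡ ∣ c - x ∣
∣-∣-mirror {x} {β} {K} {c} {n} x+β≡n K+c≡n = begin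
  ∣ K - β ∣         ≡⟨ ∣m+n-m+o∣≡∣n-o∣ x K β ⟨
  ∣ x + K - x + β ∣ ≡⟨ cong₂ ∣_-_∣ (+-comm x K) x+β≡n ⟩
  ∣ K + x - n ∣     ≡⟨ ∣-∣-comm (K + x) n ⟩
  ∣ n - K + x ∣     ≡⟨ cong (λ m → ∣ m - K + x ∣) K+c≡n ⟨
  ∣ K + c - K + x ∣ ≡⟨ ∣m+n-m+o∣≡∣n-o∣ K c x ⟩
  ∣ c - x ∣         ∎
  where open ≡-Reasoning

⊓-∸-≡⇔ : ∀ {n d e} → e ≤ n → d + d ≤ n → e ⊓ (n ∸ e) ≡ d ⇔ (e ≡ d ⊎ e ≡ n ∸ d)
⊓-∸-≡⇔ {n} {d} {e} e≤n 2d≤n = mk⇔ to from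
  where
  d≤n∸d : d ≤ n ∸ d
  d≤n∸d = m+n≤o⇒m≤o∸n d 2d≤n
  to : e ⊓ (n ∸ e) ≡ d → e ≡ d ⊎ e ≡ n ∸ d
  to eq with ⊓-sel e (n ∸ e)
  ... | inj₁ ⊓≡e   = inj₁ (trans (sym ⊓≡e) eq)
  ... | inj₂ ⊓≡n∸e = inj₂ (trans (sym (m∸[m∸n]≡n e≤n)) (cong (n ∸_) (trans (sym ⊓≡n∸e) eq)))
  from : e ≡ d ⊎ e ≡ n ∸ d → e ⊓ (n ∸ e) ≡ d
  from (inj₁ refl) = m≤n⇒m⊓n≡m d≤n∸d
  from (inj₂ refl) =
    trans (cong ((n ∸ d) ⊓_) (m∸[m∸n]≡n (≤-trans (m≤m+n d d) 2d≤n))) (m≥n⇒m⊓n≡n d≤n∸d)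

-- Residues modulo n and circular distance

-- For x, y < n: y ≡ x + d (mod n).
data Shift (n d x : ℕ) : ℕ → Set where
  plain   : ∀ {y} → x + d ≡ y     → Shift n d x y
  wrapped : ∀ {y} → x + d ≡ y + n → Shift n d x y

Shift-exists : ∀ {n d x} → x < n → d ≤ n → ∃ λ y → y < n × Shift n d x y
Shift-exists {n} {d} {x} x<n d≤n with x + d <? n
... | yes x+d<n = x + d , x+d<n , plain refl
... | no  x+d≮n = x + d ∸ n , wrapped<n , wrapped (sym (m∸n+n≡m (≮⇒≥ x+d≮n)))
  where
  wrapped<n : x + d ∸ n < n
  wrapped<n = subst (x + d ∸ n <_) (m+n∸n≡m n n) (∸-monoˡ-< (+-mono-<-≤ x<n d≤n) (≮⇒≥ x+d≮n))

Shift-exists⁻ : ∀ {n d x} → x < n → d ≤ n → ∃ λ y → y < n × Shift n d y x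
Shift-exists⁻ {n} {d} {x} x<n d≤n with d ≤? x
... | yes d≤x = x ∸ d , ≤-<-trans (m∸n≤m x d) x<n , plain (m∸n+n≡m d≤x)
... | no  d≰x = x + (n ∸ d) , wrapped<n , wrapped (+-∸-+ x d≤n)
  where
  wrapped<n : x + (n ∸ d) < n
  wrapped<n = subst (x + (n ∸ d) <_) (m+[n∸m]≡n d≤n) (+-monoˡ-< (n ∸ d) (≰⇒> d≰x))

m<n⇒m≢o+n : ∀ {m n o} → m < n → m ≢ o + n
m<n⇒m≢o+n {n = n} {o} m<n m≡o+n = <⇒≱ m<n (subst (n ≤_) (sym m≡o+n) (m≤n+m n o))

Shift-unique : ∀ {n d x y z} → y < n → z < n → Shift n d x y → Shift n d x z → y ≡ z
Shift-unique _   _   (plain p)   (plain q)   = trans (sym p) q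
Shift-unique y<n _   (plain p)   (wrapped q) = ⊥-elim (m<n⇒m≢o+n y<n (trans (sym p) q))
Shift-unique _   z<n (wrapped p) (plain q)   = ⊥-elim (m<n⇒m≢o+n z<n (trans (sym q) p))
Shift-unique {n} _ _ (wrapped p) (wrapped q) = +-cancelʳ-≡ n _ _ (trans (sym p) q)

Shift-unique⁻ : ∀ {n d x y z} → y < n → z < n → Shift n d y x → Shift n d z x → y ≡ z
Shift-unique⁻ {n} {d} {x} = unique
  where
  wraps-past : ∀ {y z} → y + d ≡ x → z + d ≡ x + n → z ≡ y + n
  wraps-past {y} p q = +-cancelʳ-≡ d _ _ (trans q (trans (cong (_+ n) (sym p)) (xy∙z≈xz∙y y d n)))
  unique : ∀ {y z} → y < n → z < n → Shift n d y x → Shift n d z x → y ≡ z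
  unique _   _   (plain p)   (plain q)   = +-cancelʳ-≡ d _ _ (trans p (sym q))
  unique _   z<n (plain p)   (wrapped q) = ⊥-elim (m<n⇒m≢o+n z<n (wraps-past p q))
  unique y<n _   (wrapped p) (plain q)   = ⊥-elim (m<n⇒m≢o+n y<n (wraps-past q p))
  unique _   _   (wrapped p) (wrapped q) = +-cancelʳ-≡ d _ _ (trans p (sym q))

Shift-antisym : ∀ {n d x y} → 1 ≤ d → d + d < n → Shift n d x y → Shift n d y x → ⊥
Shift-antisym {n} {d} {x} {y} 1≤d 2d<n = go
  where
  twice : ∀ a b → a + d ≡ b → a + (d + d) ≡ b + d
  twice a b p = trans (sym (+-assoc a d d)) (cong (_+ d) p)
  go : Shift n d x y → Shift n d y x → ⊥
  go (plain p) (plain q) = <⇒≢ (≤-trans 1≤d (m≤m+n d d))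
    (sym (+-cancelˡ-≡ x _ 0 (trans (twice x y p) (trans q (sym (+-identityʳ x))))))
  go (plain p) (wrapped q) = <⇒≢ 2d<n (+-cancelˡ-≡ x _ _ (trans (twice x y p) q))
  go (wrapped p) (plain q) = <⇒≢ 2d<n (+-cancelˡ-≡ y _ _ (trans (twice y x q) p))
  go (wrapped p) (wrapped q) = <⇒≢ (<-≤-trans 2d<n (m≤m+n n n)) (+-cancelˡ-≡ (x + y) _ _ (begin
    (x + y) + (d + d) ≡⟨ interchange x y d d ⟩
    (x + d) + (y + d) ≡⟨ cong₂ _+_ p q ⟩
    (y + n) + (x + n) ≡⟨ interchange y n x n ⟩
    (y + x) + (n + n) ≡⟨ cong (_+ (n + n)) (+-comm y x) ⟩
    (x + y) + (n + n) ∎))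
    where open ≡-Reasoning

circDist-sym : ∀ n (v w : Fin n) → circDist n v w ≡ circDist n w v
circDist-sym n v w = cong (λ e → e ⊓ (n ∸ e)) (∣-∣-comm (toℕ v) (toℕ w))

circDist≡⇔Shift : ∀ {n d x y} → x < n → y < n → d + d ≤ n →
  ∣ y - x ∣ ⊓ (n ∸ ∣ y - x ∣) ≡ d ⇔ (Shift n d x y ⊎ Shift n d y x)
circDist≡⇔Shift {n} {d} {x} {y} x<n y<n 2d≤n = mk⇔ to from ⇔-∘ ⊓-∸-≡⇔ ∣y-x∣≤n 2d≤n
  where
  open Equivalence renaming (to to ⇒; from to ⇐)
  d≤n = ≤-trans (m≤m+n d d) 2d≤n
  ∣y-x∣≤n = ≤-trans (∣m-n∣≤m⊔n y x) (⊔-lub (<⇒≤ y<n) (<⇒≤ x<n))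
  dist⇔ : ∀ {e} → ∣ y - x ∣ ≡ e ⇔ (x + e ≡ y ⊎ y + e ≡ x)
  dist⇔ = ∣-∣≡⇔
  wrap : ∀ {a b} → a + (n ∸ d) ≡ b ⇔ b + d ≡ a + n
  wrap = +-∸-≡⇔ d≤n
  to : ∣ y - x ∣ ≡ d ⊎ ∣ y - x ∣ ≡ n ∸ d → Shift n d x y ⊎ Shift n d y x
  to (inj₁ e) with ⇒ dist⇔ e
  ... | inj₁ p = inj₁ (plain p)
  ... | inj₂ q = inj₂ (plain q)
  to (inj₂ e) with ⇒ dist⇔ e
  ... | inj₁ p = inj₂ (wrapped (⇒ wrap p))
  ... | inj₂ q = inj₁ (wrapped (⇒ wrap q))
  from : Shift n d x y ⊎ Shift n d y x → ∣ y - x ∣ ≡ d ⊎ ∣ y - x ∣ ≡ n ∸ d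
  from (inj₁ (plain p))   = inj₁ (⇐ dist⇔ (inj₁ p))
  from (inj₁ (wrapped p)) = inj₂ (⇐ dist⇔ (inj₂ (⇐ wrap p)))
  from (inj₂ (plain q))   = inj₁ (⇐ dist⇔ (inj₂ q))
  from (inj₂ (wrapped q)) = inj₂ (⇐ dist⇔ (inj₁ (⇐ wrap q)))

χ-circDist≡ᵇ : ∀ {n d u₊ u₋} (w : Fin n) → 1 ≤ d → d + d < n → u₊ < n → u₋ < n →
  Shift n d (toℕ w) u₊ → Shift n d u₋ (toℕ w) →
  ∀ v → χ (circDist n v w ≡ᵇ d) ≡ χ (toℕ v ≡ᵇ u₊) + χ (toℕ v ≡ᵇ u₋)
χ-circDist≡ᵇ {n} {d} {u₊} {u₋} w 1≤d 2d<n u₊<n u₋<n up down v = trans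
  (cong χ (does-⇔ neighbour⇔ (circDist n v w ≟ℕ d) ((toℕ v ≟ℕ u₊) ⊎-dec (toℕ v ≟ℕ u₋))))
  (χ-∨-disjoint _ _ distinct)
  where
  x = toℕ w
  y<n = Fin.toℕ<n v
  neighbour⇔ : circDist n v w ≡ d ⇔ (toℕ v ≡ u₊ ⊎ toℕ v ≡ u₋)
  neighbour⇔ = mk⇔
    [ (λ s → inj₁ (Shift-unique y<n u₊<n s up)) , (λ s → inj₂ (Shift-unique⁻ y<n u₋<n s down)) ]
    [ (λ e → inj₁ (subst (Shift n d x) (sym e) up))
    , (λ e → inj₂ (subst (λ y → Shift n d y x) (sym e) down)) ]
    ⇔-∘ circDist≡⇔Shift (Fin.toℕ<n w) y<n (<⇒≤ 2d<n)
  distinct : ¬ (T (toℕ v ≡ᵇ u₊) × T (toℕ v ≡ᵇ u₋))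
  distinct (p , q) = Shift-antisym 1≤d 2d<n
    (subst (Shift n d x) (sym (≡ᵇ⇒≡ (toℕ v) u₊ p)) up)
    (subst (λ y → Shift n d y x) (sym (≡ᵇ⇒≡ (toℕ v) u₋ q)) down)

count-at-distance : ∀ {n d} (w : Fin n) (R : ℕ → Bool) → 1 ≤ d → d + d < n →
  (∀ y → Shift n d (toℕ w) y → R y ≡ R (toℕ w + d)) →
  (∀ y → y < n → Shift n d y (toℕ w) → R y ≡ R (toℕ w ∸ d)) →
  ∑[ v < n ] (χ (circDist n v w ≡ᵇ d) * χ (R (toℕ v)))
    ≡ χ (R (toℕ w + d)) + χ (R (toℕ w ∸ d))
count-at-distance {n} {d} w R 1≤d 2d<n R-up R-down =
  go (Shift-exists x<n d≤n) (Shift-exists⁻ x<n d≤n)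
  where
  x = toℕ w
  x<n = Fin.toℕ<n w
  d≤n = ≤-trans (m≤m+n d d) (<⇒≤ 2d<n)
  r : Fin n → ℕ
  r v = χ (R (toℕ v))
  go : (∃ λ y → y < n × Shift n d x y) → (∃ λ y → y < n × Shift n d y x) →
    ∑[ v < n ] (χ (circDist n v w ≡ᵇ d) * r v) ≡ χ (R (x + d)) + χ (R (x ∸ d))
  go (u₊ , u₊<n , up) (u₋ , u₋<n , down) = begin
    ∑[ v < n ] (χ (circDist n v w ≡ᵇ d) * r v)
      ≡⟨ sum-cong-≗ (λ v → cong (_* r v) (χ-circDist≡ᵇ w 1≤d 2d<n u₊<n u₋<n up down v)) ⟩
    ∑[ v < n ] ((χ (toℕ v ≡ᵇ u₊) + χ (toℕ v ≡ᵇ u₋)) * r v)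
      ≡⟨ sum-cong-≗ (λ v → *-distribʳ-+ (r v) (χ (toℕ v ≡ᵇ u₊)) _) ⟩
    ∑[ v < n ] (χ (toℕ v ≡ᵇ u₊) * r v + χ (toℕ v ≡ᵇ u₋) * r v)
      ≡⟨ ∑-distrib-+ (λ v → χ (toℕ v ≡ᵇ u₊) * r v) _ ⟩
    ∑[ v < n ] (χ (toℕ v ≡ᵇ u₊) * r v) + ∑[ v < n ] (χ (toℕ v ≡ᵇ u₋) * r v)
      ≡⟨ cong₂ _+_ (∑-indicator-toℕ (χ ∘ R) u₊<n) (∑-indicator-toℕ (χ ∘ R) u₋<n) ⟩
    χ (R u₊) + χ (R u₋)
      ≡⟨ cong₂ _+_ (cong χ (R-up u₊ up)) (cong χ (R-down u₋ u₋<n down)) ⟩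
    χ (R (x + d)) + χ (R (x ∸ d)) ∎
    where open ≡-Reasoning

-- Tents

∸-suc-χ : ∀ d e → d ∸ e ≡ d ∸ suc e + χ (e <ᵇ d)
∸-suc-χ zero    zero    = refl
∸-suc-χ zero    (suc e) = refl
∸-suc-χ (suc d) zero    = sym (+-comm d 1)
∸-suc-χ (suc d) (suc e) = ∸-suc-χ d e

∸-suc-χ′ : ∀ d e → d ∸ suc e + 1 ≡ d ∸ e + χ (d ≤ᵇ e)
∸-suc-χ′ d e = begin
  d ∸ suc e + 1                               ≡⟨ cong (λ t → d ∸ suc e + t) (χ-<ᵇ+χ-≤ᵇ e d) ⟨
  d ∸ suc e + (χ (e <ᵇ d) + χ (d ≤ᵇ e))       ≡⟨ +-assoc (d ∸ suc e) _ _ ⟨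
  d ∸ suc e + χ (e <ᵇ d) + χ (d ≤ᵇ e)         ≡⟨ cong (_+ χ (d ≤ᵇ e)) (∸-suc-χ d e) ⟨
  d ∸ e + χ (d ≤ᵇ e)                          ∎
  where open ≡-Reasoning

∸≤⇔< : ∀ c e d → (suc c + e ∸ d ≤ c) ⇔ (e < d)
∸≤⇔< c e d = mk⇔
  (λ le → +-cancelˡ-< c e d (subst (suc c + e ≤_) (+-comm d c) (Equivalence.to (∸≤⇔ _ d c) le)))
  (λ e<d → Equivalence.from (∸≤⇔ _ d c) (subst (suc c + e ≤_) (+-comm c d) (+-monoʳ-< c e<d)))

∣1+m+n-m∣≡1+n : ∀ m n → ∣ suc (m + n) - m ∣ ≡ suc n
∣1+m+n-m∣≡1+n m n = trans (cong (λ y → ∣ y - m ∣) (sym (+-suc m n))) (∣m+n-m∣≡n m (suc n))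

∣m-1+m+n∣≡1+n : ∀ m n → ∣ m - suc (m + n) ∣ ≡ suc n
∣m-1+m+n∣≡1+n m n = trans (∣-∣-comm m (suc (m + n))) (∣1+m+n-m∣≡1+n m n)

tent-shiftˡ : ∀ d c x →
  (d ∸ ∣ suc c - x ∣) + χ (x ≤ᵇ c) * 2 ≡ (d ∸ ∣ c - x ∣) + (χ (x + d ≤ᵇ c) + χ (x ∸ d ≤ᵇ c))
tent-shiftˡ d c x with x ≤? c
... | yes x≤c with m≤n⇒∃[o]m+o≡n x≤c
...   | e , refl = begin
  d ∸ ∣ suc (x + e) - x ∣ + χ (x ≤ᵇ x + e) * 2
    ≡⟨ cong₂ (λ t b → d ∸ t + b * 2) (∣1+m+n-m∣≡1+n x e) (χ-≤ᵇ-true (m≤m+n x e)) ⟩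
  d ∸ suc e + 2                 ≡⟨ +-assoc (d ∸ suc e) 1 1 ⟨
  d ∸ suc e + 1 + 1             ≡⟨ cong (_+ 1) (∸-suc-χ′ d e) ⟩
  d ∸ e + χ (d ≤ᵇ e) + 1        ≡⟨ +-assoc (d ∸ e) _ 1 ⟩
  d ∸ e + (χ (d ≤ᵇ e) + 1)
    ≡⟨ cong₂ (λ t u → d ∸ t + u) (∣m+n-m∣≡n x e) (cong₂ _+_ (χ-+-≤ᵇ x d e) (χ-≤ᵇ-true x∸d≤x+e)) ⟨
  d ∸ ∣ x + e - x ∣ + (χ (x + d ≤ᵇ x + e) + χ (x ∸ d ≤ᵇ x + e)) ∎
  where
  open ≡-Reasoning
  x∸d≤x+e = ≤-trans (m∸n≤m x d) (m≤m+n x e)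
tent-shiftˡ d c x | no x≰c with m≤n⇒∃[o]m+o≡n (≰⇒> x≰c)
...   | e , refl = begin
  d ∸ ∣ suc c - suc c + e ∣ + χ (suc c + e ≤ᵇ c) * 2
    ≡⟨ cong₂ (λ t b → d ∸ t + b * 2) (∣m-m+n∣≡n (suc c) e) (χ-≤ᵇ-false (s≤s (m≤m+n c e))) ⟩
  d ∸ e + 0                     ≡⟨ +-identityʳ (d ∸ e) ⟩
  d ∸ e                         ≡⟨ ∸-suc-χ d e ⟩
  d ∸ suc e + χ (e <ᵇ d)
    ≡⟨ cong₂ (λ t u → d ∸ t + u) (∣m-1+m+n∣≡1+n c e) (cong₂ _+_ (χ-≤ᵇ-false c<x+d) wrap) ⟨
  d ∸ ∣ c - suc c + e ∣ + (χ (suc c + e + d ≤ᵇ c) + χ (suc c + e ∸ d ≤ᵇ c)) ∎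
  where
  open ≡-Reasoning
  c<x+d = s≤s (≤-trans (m≤m+n c e) (m≤m+n (c + e) d))
  wrap : χ (suc c + e ∸ d ≤ᵇ c) ≡ χ (e <ᵇ d)
  wrap = cong χ (does-⇔ (∸≤⇔< c e d) (suc c + e ∸ d ≤? c) (e <? d))

tent-shiftʳ : ∀ d c x →
  (d ∸ ∣ c - x ∣) + χ (c <ᵇ x) * 2 ≡ (d ∸ ∣ suc c - x ∣) + (χ (c <ᵇ x + d) + χ (c <ᵇ x ∸ d))
tent-shiftʳ d c x with x ≤? c
... | yes x≤c with m≤n⇒∃[o]m+o≡n x≤c
...   | e , refl = begin
  d ∸ ∣ x + e - x ∣ + χ (x + e <ᵇ x) * 2
    ≡⟨ cong₂ (λ t b → d ∸ t + b * 2) (∣m+n-m∣≡n x e) (χ-≤ᵇ-false (s≤s (m≤m+n x e))) ⟩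
  d ∸ e + 0                     ≡⟨ +-identityʳ (d ∸ e) ⟩
  d ∸ e                         ≡⟨ ∸-suc-χ d e ⟩
  d ∸ suc e + χ (e <ᵇ d)        ≡⟨ cong (λ t → d ∸ suc e + t) (+-identityʳ (χ (e <ᵇ d))) ⟨
  d ∸ suc e + (χ (e <ᵇ d) + 0)
    ≡⟨ cong₂ (λ t u → d ∸ t + u) (∣1+m+n-m∣≡1+n x e) (cong₂ _+_ (χ-+-<ᵇ x e d) (χ-≤ᵇ-false x∸d<1+x+e)) ⟨
  d ∸ ∣ suc (x + e) - x ∣ + (χ (x + e <ᵇ x + d) + χ (x + e <ᵇ x ∸ d)) ∎
  where
  open ≡-Reasoning
  x∸d<1+x+e = s≤s (≤-trans (m∸n≤m x d) (m≤m+n x e))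
tent-shiftʳ d c x | no x≰c with m≤n⇒∃[o]m+o≡n (≰⇒> x≰c)
...   | e , refl = begin
  d ∸ ∣ c - suc c + e ∣ + χ (c <ᵇ suc c + e) * 2
    ≡⟨ cong₂ (λ t b → d ∸ t + b * 2) (∣m-1+m+n∣≡1+n c e) (χ-≤ᵇ-true (s≤s (m≤m+n c e))) ⟩
  d ∸ suc e + 2                 ≡⟨ +-assoc (d ∸ suc e) 1 1 ⟨
  d ∸ suc e + 1 + 1             ≡⟨ cong (_+ 1) (∸-suc-χ′ d e) ⟩
  d ∸ e + χ (d ≤ᵇ e) + 1        ≡⟨ xy∙z≈xz∙y (d ∸ e) _ 1 ⟩
  d ∸ e + 1 + χ (d ≤ᵇ e)        ≡⟨ +-assoc (d ∸ e) 1 _ ⟩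
  d ∸ e + (1 + χ (d ≤ᵇ e))
    ≡⟨ cong₂ (λ t u → d ∸ t + u) (∣m-m+n∣≡n (suc c) e) (cong₂ _+_ (χ-≤ᵇ-true c<x+d) wrap) ⟨
  d ∸ ∣ suc c - suc c + e ∣ + (χ (c <ᵇ suc c + e + d) + χ (c <ᵇ suc c + e ∸ d)) ∎
  where
  open ≡-Reasoning
  c<x+d = s≤s (≤-trans (m≤m+n c e) (m≤m+n (c + e) d))
  flipped : c < suc c + e ∸ d ⇔ d ≤ e
  flipped = mk⇔ (λ lt → ≮⇒≥ (λ e<d → <⇒≱ lt (Equivalence.from (∸≤⇔< c e d) e<d)))
                (λ d≤e → ≰⇒> (λ le → <⇒≱ (Equivalence.to (∸≤⇔< c e d) le) d≤e))
  wrap : χ (c <ᵇ suc c + e ∸ d) ≡ χ (d ≤ᵇ e)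
  wrap = cong χ (does-⇔ flipped (c <? suc c + e ∸ d) (d ≤? e))

outside : ℕ → ℕ → ℕ → Bool
outside c₁ c₂ y = (y ≤ᵇ c₁) ∨ (c₂ <ᵇ y)

χ-outside : ∀ {c₁ c₂} → c₁ ≤ c₂ → ∀ y → χ (outside c₁ c₂ y) ≡ χ (y ≤ᵇ c₁) + χ (c₂ <ᵇ y)
χ-outside {c₁} {c₂} c₁≤c₂ y =
  χ-∨-disjoint _ _ (λ (p , q) → <⇒≱ (<ᵇ⇒< c₂ y q) (≤-trans (≤ᵇ⇒≤ y c₁ p) c₁≤c₂))

outside-left : ∀ {c₁ c₂ y} → y ≤ c₁ → outside c₁ c₂ y ≡ true
outside-left {c₁} {c₂} {y} y≤c₁ = cong (_∨ (c₂ <ᵇ y)) (dec-true (y ≤? c₁) y≤c₁)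

outside-right : ∀ {c₁ c₂ y} → c₂ < y → outside c₁ c₂ y ≡ true
outside-right {c₁} {c₂} {y} c₂<y =
  trans (cong ((y ≤ᵇ c₁) ∨_) (dec-true (c₂ <? y) c₂<y)) (∨-zeroʳ (y ≤ᵇ c₁))

tent-shift : ∀ {c₁ c₂} → c₁ ≤ c₂ → ∀ d x →
  (d ∸ ∣ suc c₁ - x ∣) + (d ∸ ∣ c₂ - x ∣) + χ (outside c₁ c₂ x) * 2
    ≡ (d ∸ ∣ c₁ - x ∣) + (d ∸ ∣ suc c₂ - x ∣)
      + (χ (outside c₁ c₂ (x + d)) + χ (outside c₁ c₂ (x ∸ d)))
tent-shift {c₁} {c₂} c₁≤c₂ d x = begin
  a₁ + b₀ + χ (outside c₁ c₂ x) * 2   ≡⟨ cong (λ t → a₁ + b₀ + t * 2) (χ-outside c₁≤c₂ x) ⟩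
  a₁ + b₀ + (p + q) * 2               ≡⟨ regroup a₁ b₀ p q ⟩
  (a₁ + p * 2) + (b₀ + q * 2)         ≡⟨ cong₂ _+_ (tent-shiftˡ d c₁ x) (tent-shiftʳ d c₂ x) ⟩
  (a₀ + (p₊ + p₋)) + (b₁ + (q₊ + q₋)) ≡⟨ regroup′ a₀ p₊ p₋ b₁ q₊ q₋ ⟩
  a₀ + b₁ + ((p₊ + q₊) + (p₋ + q₋))   ≡⟨ cong (λ t → a₀ + b₁ + t)
                                           (cong₂ _+_ (χ-outside c₁≤c₂ (x + d)) (χ-outside c₁≤c₂ (x ∸ d))) ⟨
  a₀ + b₁ + (χ (outside c₁ c₂ (x + d)) + χ (outside c₁ c₂ (x ∸ d))) ∎
  where
  open ≡-Reasoning
  a₀ = d ∸ ∣ c₁ - x ∣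
  a₁ = d ∸ ∣ suc c₁ - x ∣
  b₀ = d ∸ ∣ c₂ - x ∣
  b₁ = d ∸ ∣ suc c₂ - x ∣
  p = χ (x ≤ᵇ c₁)
  q = χ (c₂ <ᵇ x)
  p₊ = χ (x + d ≤ᵇ c₁)
  p₋ = χ (x ∸ d ≤ᵇ c₁)
  q₊ = χ (c₂ <ᵇ x + d)
  q₋ = χ (c₂ <ᵇ x ∸ d)
  regroup : ∀ a b p q → a + b + (p + q) * 2 ≡ (a + p * 2) + (b + q * 2)
  regroup = ℕ-Solver.solve-∀
  regroup′ : ∀ a p p′ b q q′ → (a + (p + p′)) + (b + (q + q′)) ≡ a + b + ((p + q) + (p′ + q′))
  regroup′ = ℕ-Solver.solve-∀

bump-∑ : ∀ {k'} (j : Fin (suc k') → ℕ) c x → bump j c x ≡ ∑[ a < suc k' ] (j a ∸ ∣ c - x ∣)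
bump-∑ j c x = sum-map-allFin (λ a → j a ∸ ∣ c - x ∣)

bump-pos : ∀ {k'} (j : Fin (suc k') → ℕ) a {c x} → ∣ c - x ∣ < j a → 1 ≤ bump j c x
bump-pos j a {c} {x} lt = subst (1 ≤_) (sym (bump-∑ j c x))
  (≤-trans (m<n⇒0<n∸m lt) (term≤∑ (λ b → j b ∸ ∣ c - x ∣) a))

bump-vanish : ∀ {k'} (j : Fin (suc k') → ℕ) {K c x} →
  (∀ a → j a ≤ K) → K ≤ ∣ c - x ∣ → bump j c x ≡ 0
bump-vanish j {K} {c} {x} j≤K far =
  trans (bump-∑ j c x) (∑-zero _ (λ a → m≤n⇒m∸n≡0 (≤-trans (j≤K a) far)))

bump-shift : ∀ {k'} (j : Fin (suc k') → ℕ) {c₁ c₂} → c₁ ≤ c₂ → ∀ x →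
  bump j (suc c₁) x + bump j c₂ x + χ (outside c₁ c₂ x) * ∑[ a < suc k' ] 2
    ≡ bump j c₁ x + bump j (suc c₂) x
      + ∑[ a < suc k' ] (χ (outside c₁ c₂ (x + j a)) + χ (outside c₁ c₂ (x ∸ j a)))
bump-shift {k'} j {c₁} {c₂} c₁≤c₂ x = begin
  bump j (suc c₁) x + bump j c₂ x + χ (O x) * ∑[ a < suc k' ] 2
    ≡⟨ cong₂ _+_ (cong₂ _+_ (bump-∑ j (suc c₁) x) (bump-∑ j c₂ x))
                 (*-distribˡ-sum {suc k'} (χ (O x)) (λ _ → 2)) ⟩
  ∑[ a < suc k' ] t (suc c₁) a + ∑[ a < suc k' ] t c₂ a + ∑[ a < suc k' ] (χ (O x) * 2)
    ≡⟨ ∑-distrib-+₃ (t (suc c₁)) (t c₂) (λ _ → χ (O x) * 2) ⟨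
  ∑[ a < suc k' ] (t (suc c₁) a + t c₂ a + χ (O x) * 2)
    ≡⟨ sum-cong-≗ (λ a → tent-shift c₁≤c₂ (j a) x) ⟩
  ∑[ a < suc k' ] (t c₁ a + t (suc c₂) a + N a)
    ≡⟨ ∑-distrib-+₃ (t c₁) (t (suc c₂)) N ⟩
  ∑[ a < suc k' ] t c₁ a + ∑[ a < suc k' ] t (suc c₂) a + ∑[ a < suc k' ] N a
    ≡⟨ cong (_+ ∑[ a < suc k' ] N a) (cong₂ _+_ (bump-∑ j c₁ x) (bump-∑ j (suc c₂) x)) ⟨
  bump j c₁ x + bump j (suc c₂) x + ∑[ a < suc k' ] N a ∎
  where
  open ≡-Reasoning
  O = outside c₁ c₂
  t : ℕ → Fin (suc k') → ℕ
  t c a = j a ∸ ∣ c - x ∣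
  N : Fin (suc k') → ℕ
  N a = χ (O (x + j a)) + χ (O (x ∸ j a))

-- Chip-firing on Ci_n(J)

module _ (n : ℕ) {k' : ℕ} (j : Fin (suc k') → ℕ) where

  fire-minusPt : ∀ v D q w → fire n j v (minusPt D q) w ≡ minusPt (fire n j v D) q w
  fire-minusPt v D q w with w ≟ q | w ≟ v | adjᵇ n j v w
  ... | yes _ | yes _ | _     = swap (D w) (+ 1) (+ degree n j v)
    where
    swap : ∀ a b c → a ℤ.- b ℤ.- c ≡ a ℤ.- c ℤ.- b
    swap = ℤ-Solver.solve-∀
  ... | yes _ | no _  | true  = swap (D w) (+ 1) (+ 1)
    where
    swap : ∀ a b c → a ℤ.- b ℤ.+ c ≡ a ℤ.+ c ℤ.- b
    swap = ℤ-Solver.solve-∀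
  ... | yes _ | no _  | false = refl
  ... | no _  | yes _ | _     = refl
  ... | no _  | no _  | true  = refl
  ... | no _  | no _  | false = refl

  minusPt-Equiv : ∀ {D E : Divisor n} q → Equiv n j D E → Equiv n j (minusPt D q) (minusPt E q)
  minusPt-Equiv q = gmap (λ D → minusPt D q) λ { {D} (v , E≡) →
    v , λ w → trans (cong (λ e → if does (w ≟ q) then e ℤ.- + 1 else e) (E≡ w))
                    (sym (fire-minusPt v D q w)) }

  minusPt-Effective : ∀ {E : Divisor n} q → Effective E → + 1 ℤ.≤ E q → Effective (minusPt E q)
  minusPt-Effective q E≥0 1≤Eq w with w ≟ q
  ... | yes refl = ℤ.i≤j⇒0≤j-i 1≤Eq
  ... | no _     = E≥0 w

  positiveRank-at : ∀ {D E : Divisor n} q → Equiv n j D E → Effective E → + 1 ℤ.≤ E q →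
    ∃ λ E′ → Effective E′ × Equiv n j (minusPt D q) E′
  positiveRank-at {E = E} q D~E E≥0 1≤Eq =
    minusPt E q , minusPt-Effective q E≥0 1≤Eq , minusPt-Equiv q D~E

module Circulant {n k' : ℕ} (j : Fin (suc k') → ℕ) (j-pos : ∀ a → 1 ≤ j a) where

  adjᵇ-sym : ∀ v w → adjᵇ n j v w ≡ adjᵇ n j w v
  adjᵇ-sym v w = cong (λ d → any (λ a → d ≡ᵇ j a) (allFin _)) (circDist-sym n v w)

  adjᵇ-irrefl : ∀ w → χ (adjᵇ n j w w) ≡ 0
  adjᵇ-irrefl w rewrite ∣n-n∣≡0 (toℕ w) =
    trans (χ-any-tabulate (λ a → 0 ≡ᵇ j a) (λ a → a) never)
          (∑-zero _ (λ a → cong χ (≡ᵇ-zero-pos (j-pos a))))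
    where
    never : ∀ a b → T (0 ≡ᵇ j a) → T (0 ≡ᵇ j b) → a ≡ b
    never a _ t = ⊥-elim (subst T (≡ᵇ-zero-pos (j-pos a)) t)

  fireAll : List (Fin n) → Divisor n → Divisor n
  fireAll []       D = D
  fireAll (v ∷ vs) D = fireAll vs (fire n j v D)

  fireAll-Equiv : ∀ vs D → Equiv n j D (fireAll vs D)
  fireAll-Equiv []       D = ε
  fireAll-Equiv (v ∷ vs) D = (v , λ _ → refl) ◅ fireAll-Equiv vs (fire n j v D)

  fire-balance : ∀ v D w →
    fire n j v D w ℤ.+ + (χ (does (w ≟ v)) * degree n j w) ≡ D w ℤ.+ + χ (adjᵇ n j v w)
  fire-balance v D w with w ≟ v
  ... | yes refl = begin
    (D w ℤ.- + d) ℤ.+ + (d + 0) ≡⟨ cong (λ e → (D w ℤ.- + d) ℤ.+ + e) (+-identityʳ d) ⟩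
    (D w ℤ.- + d) ℤ.+ + d       ≡⟨ minus-plus (D w) (+ d) ⟩
    D w ℤ.+ + 0                 ≡⟨ cong (λ e → D w ℤ.+ + e) (adjᵇ-irrefl w) ⟨
    D w ℤ.+ + χ (adjᵇ n j w w)  ∎
    where
    open ≡-Reasoning
    d = degree n j w
    minus-plus : ∀ x y → (x ℤ.- y) ℤ.+ y ≡ x ℤ.+ + 0
    minus-plus = ℤ-Solver.solve-∀
  ... | no _ with adjᵇ n j v w
  ...   | true  = ℤ.+-identityʳ (D w ℤ.+ + 1)
  ...   | false = refl

  fireAll-balance : ∀ vs D w →
    fireAll vs D w ℤ.+ + (List.sum (map (χ ∘ does ∘ (w ≟_)) vs) * degree n j w)
      ≡ D w ℤ.+ + List.sum (map (χ ∘ (λ v → adjᵇ n j v w)) vs)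
  fireAll-balance []       D w = refl
  fireAll-balance (v ∷ vs) D w = begin
    X ℤ.+ + ((δ + c) * d)         ≡⟨ cong (λ e → X ℤ.+ + e) (*-distribʳ-+ d δ c) ⟩
    X ℤ.+ + (δ * d + c * d)       ≡⟨ cong (λ e → X ℤ.+ e) (ℤ.pos-+ (δ * d) (c * d)) ⟩
    X ℤ.+ (+ (δ * d) ℤ.+ + (c * d)) ≡⟨ swap X (+ (δ * d)) (+ (c * d)) ⟩
    (X ℤ.+ + (c * d)) ℤ.+ + (δ * d) ≡⟨ cong (ℤ._+ + (δ * d)) (fireAll-balance vs F w) ⟩
    (F w ℤ.+ + a) ℤ.+ + (δ * d)   ≡⟨ swap′ (F w) (+ a) (+ (δ * d)) ⟩
    (F w ℤ.+ + (δ * d)) ℤ.+ + a   ≡⟨ cong (ℤ._+ + a) (fire-balance v D w) ⟩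
    (D w ℤ.+ + α) ℤ.+ + a         ≡⟨ ℤ.+-assoc (D w) (+ α) (+ a) ⟩
    D w ℤ.+ (+ α ℤ.+ + a)         ≡⟨ cong (λ e → D w ℤ.+ e) (ℤ.pos-+ α a) ⟨
    D w ℤ.+ + (α + a)             ∎
    where
    open ≡-Reasoning
    F = fire n j v D
    X = fireAll vs F w
    d = degree n j w
    δ = χ (does (w ≟ v))
    c = List.sum (map (χ ∘ does ∘ (w ≟_)) vs)
    α = χ (adjᵇ n j v w)
    a = List.sum (map (χ ∘ (λ v → adjᵇ n j v w)) vs)
    swap : ∀ x y z → x ℤ.+ (y ℤ.+ z) ≡ (x ℤ.+ z) ℤ.+ y
    swap = ℤ-Solver.solve-∀
    swap′ : ∀ x y z → (x ℤ.+ y) ℤ.+ z ≡ (x ℤ.+ z) ℤ.+ y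
    swap′ = ℤ-Solver.solve-∀

  fireSet : (Fin n → Bool) → Divisor n → Divisor n
  fireSet S = fireAll (filter (T? ∘ S) (allFin n))

  fireSet-Equiv : ∀ S D → Equiv n j D (fireSet S D)
  fireSet-Equiv S = fireAll-Equiv (filter (T? ∘ S) (allFin n))

  neighbours : (Fin n → Bool) → Fin n → ℕ
  neighbours S w = ∑[ v < n ] (χ (adjᵇ n j v w) * χ (S v))

  fireSet-balance : ∀ S D w → fireSet S D w ℤ.+ + (χ (S w) * degree n j w) ≡ D w ℤ.+ + neighbours S w
  fireSet-balance S D w = begin
    fireSet S D w ℤ.+ + (χ (S w) * degree n j w)
      ≡⟨ cong (λ e → fireSet S D w ℤ.+ + (e * degree n j w))
              (trans (count (does ∘ (w ≟_))) (∑-indicator-≟ w (χ ∘ S))) ⟨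
    fireSet S D w ℤ.+ + (List.sum (map (χ ∘ does ∘ (w ≟_)) vs) * degree n j w)
      ≡⟨ fireAll-balance vs D w ⟩
    D w ℤ.+ + List.sum (map (χ ∘ (λ v → adjᵇ n j v w)) vs)
      ≡⟨ cong (λ e → D w ℤ.+ + e) (count (λ v → adjᵇ n j v w)) ⟩
    D w ℤ.+ + neighbours S w ∎
    where
    open ≡-Reasoning
    vs = filter (T? ∘ S) (allFin n)
    count : ∀ p → List.sum (map (χ ∘ p) vs) ≡ ∑[ v < n ] (χ (p v) * χ (S v))
    count p = trans (sum-map-χ-filter p S (allFin n)) (sum-map-allFin (λ v → χ (p v) * χ (S v)))

  degree-neighbours : ∀ w → degree n j w ≡ neighbours (λ _ → true) w
  degree-neighbours w = begin
    degree n j w                               ≡⟨ length-filter-χ (adjᵇ n j w) (allFin n) ⟩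
    List.sum (map (χ ∘ adjᵇ n j w) (allFin n)) ≡⟨ sum-map-allFin (χ ∘ adjᵇ n j w) ⟩
    ∑[ v < n ] χ (adjᵇ n j w v)                ≡⟨ sum-cong-≗ (λ v → trans (cong χ (adjᵇ-sym w v))
                                                                              (sym (*-identityʳ _))) ⟩
    neighbours (λ _ → true) w                  ∎
    where open ≡-Reasoning

  Tents : ℕ → ℕ → Divisor n
  Tents c₁ c₂ w = + (bump j c₁ (toℕ w) + bump j c₂ (toℕ w))

  bump-centre : ∀ c → 1 ≤ bump j c c
  bump-centre c = bump-pos j zero {c} {c} (subst (_< j zero) (sym (∣n-n∣≡0 c)) (j-pos zero))

  Tents-chip : ∀ {E c c′} w → E ≗ Tents c c′ → toℕ w ≡ c ⊎ toℕ w ≡ c′ → Effective E × + 1 ℤ.≤ E w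
  Tents-chip {E} {c} {c′} w E≗ centred = (λ v → subst (ℤ._≥ + 0) (sym (E≗ v)) (ℤ.+≤+ z≤n)) ,
    subst (+ 1 ℤ.≤_) (sym (E≗ w)) (ℤ.+≤+ (chip centred))
    where
    chip : toℕ w ≡ c ⊎ toℕ w ≡ c′ → 1 ≤ bump j c (toℕ w) + bump j c′ (toℕ w)
    chip (inj₁ refl) = ≤-trans (bump-centre c) (m≤m+n (bump j c c) (bump j c′ c))
    chip (inj₂ refl) = ≤-trans (bump-centre c′) (m≤n+m (bump j c′ c′) (bump j c c′))

  module Neighbourhoods (j-injective : ∀ {a b} → j a ≡ j b → a ≡ b)
                        (j-small : ∀ a → j a + j a < n) where

    χ-adjᵇ : ∀ v w → χ (adjᵇ n j v w) ≡ ∑[ a < suc k' ] χ (circDist n v w ≡ᵇ j a)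
    χ-adjᵇ v w = χ-any-tabulate (λ a → circDist n v w ≡ᵇ j a) (λ a → a)
      (λ a b p q → j-injective (trans (sym (≡ᵇ⇒≡ _ (j a) p)) (≡ᵇ⇒≡ (circDist n v w) (j b) q)))

    neighbours-circulant : ∀ (R : ℕ → Bool) w →
      (∀ a y → Shift n (j a) (toℕ w) y → R y ≡ R (toℕ w + j a)) →
      (∀ a y → y < n → Shift n (j a) y (toℕ w) → R y ≡ R (toℕ w ∸ j a)) →
      neighbours (R ∘ toℕ) w ≡ ∑[ a < suc k' ] (χ (R (toℕ w + j a)) + χ (R (toℕ w ∸ j a)))
    neighbours-circulant R w R-up R-down = begin
      ∑[ v < n ] (χ (adjᵇ n j v w) * r v)
        ≡⟨ sum-cong-≗ (λ v → cong (_* r v) (χ-adjᵇ v w)) ⟩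
      ∑[ v < n ] (∑[ a < suc k' ] χ (circDist n v w ≡ᵇ j a) * r v)
        ≡⟨ sum-cong-≗ (λ v → *-distribʳ-sum (r v) (λ a → χ (circDist n v w ≡ᵇ j a))) ⟩
      ∑[ v < n ] ∑[ a < suc k' ] (χ (circDist n v w ≡ᵇ j a) * r v)
        ≡⟨ ∑-comm (λ v a → χ (circDist n v w ≡ᵇ j a) * r v) ⟩
      ∑[ a < suc k' ] ∑[ v < n ] (χ (circDist n v w ≡ᵇ j a) * r v)
        ≡⟨ sum-cong-≗ (λ a → count-at-distance w R (j-pos a) (j-small a) (R-up a) (R-down a)) ⟩
      ∑[ a < suc k' ] (χ (R (toℕ w + j a)) + χ (R (toℕ w ∸ j a))) ∎
      where
      open ≡-Reasoning
      r : Fin n → ℕ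
      r v = χ (R (toℕ v))

    degree-circulant : ∀ w → degree n j w ≡ ∑[ a < suc k' ] 2
    degree-circulant w = trans (degree-neighbours w)
      (neighbours-circulant (λ _ → true) w (λ _ _ _ → refl) (λ _ _ _ _ → refl))


    module _ {K : ℕ} (j≤K : ∀ a → j a ≤ K) where

      outside-up : ∀ {c₁ c₂} → K ≤ suc c₁ → suc c₂ + K ≤ n → ∀ (w : Fin n) a y →
        Shift n (j a) (toℕ w) y → outside c₁ c₂ y ≡ outside c₁ c₂ (toℕ w + j a)
      outside-up {c₁} {c₂} _ _ w a y (plain p) = cong (outside c₁ c₂) (sym p)
      outside-up {c₁} {c₂} K≤1+c₁ fits w a y (wrapped p) =
        trans (outside-left y≤c₁) (sym (outside-right c₂<x+d))
        where
        y≤c₁ : y ≤ c₁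
        y≤c₁ = s≤s⁻¹ (+-cancelʳ-< n y (suc c₁)
          (subst₂ _<_ p (+-comm n (suc c₁)) (+-mono-<-≤ (Fin.toℕ<n w) (≤-trans (j≤K a) K≤1+c₁))))
        c₂<x+d : c₂ < toℕ w + j a
        c₂<x+d = ≤-trans (m+n≤o⇒m≤o (suc c₂) fits) (subst (n ≤_) (sym p) (m≤n+m n y))

      outside-down : ∀ {c₁ c₂} → K ≤ suc c₁ → suc c₂ + K ≤ n → ∀ (w : Fin n) a y → y < n →
        Shift n (j a) y (toℕ w) → outside c₁ c₂ y ≡ outside c₁ c₂ (toℕ w ∸ j a)
      outside-down {c₁} {c₂} _ _ w a y _ (plain p) =
        cong (outside c₁ c₂) (trans (sym (m+n∸n≡m y (j a))) (cong (_∸ j a) p))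
      outside-down {c₁} {c₂} _ fits w a y y<n (wrapped p) =
        trans (outside-right c₂<y) (sym (outside-left x∸d≤c₁))
        where
        c₂<y : c₂ < y
        c₂<y = +-cancelʳ-≤ (j a) (suc c₂) y
          (≤-trans (+-monoʳ-≤ (suc c₂) (j≤K a)) (≤-trans fits (subst (n ≤_) (sym p) (m≤n+m n (toℕ w)))))
        x<d : toℕ w < j a
        x<d = +-cancelʳ-< n (toℕ w) (j a) (subst₂ _<_ p (+-comm n (j a)) (+-monoˡ-< (j a) y<n))
        x∸d≤c₁ : toℕ w ∸ j a ≤ c₁
        x∸d≤c₁ = subst (_≤ c₁) (sym (m≤n⇒m∸n≡0 (<⇒≤ x<d))) z≤n

      fireSet-Tents : ∀ {c₁ c₂} → c₁ ≤ c₂ → K ≤ suc c₁ → suc c₂ + K ≤ n →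
        ∀ D → D ≗ Tents c₁ (suc c₂) → fireSet (outside c₁ c₂ ∘ toℕ) D ≗ Tents (suc c₁) c₂
      fireSet-Tents {c₁} {c₂} c₁≤c₂ K≤1+c₁ fits D D≗ w = ∙-cancelʳ (+ P) _ _ (begin
        fireSet (O ∘ toℕ) D w ℤ.+ + P         ≡⟨ fireSet-balance (O ∘ toℕ) D w ⟩
        D w ℤ.+ + neighbours (O ∘ toℕ) w      ≡⟨ cong₂ (λ s t → s ℤ.+ + t) (D≗ w)
            (neighbours-circulant O w (outside-up K≤1+c₁ fits w) (outside-down K≤1+c₁ fits w)) ⟩
        + B₀ ℤ.+ + N                          ≡⟨ ℤ.pos-+ B₀ N ⟨
        + (B₀ + N)                            ≡⟨ cong +_ (bump-shift j c₁≤c₂ x) ⟨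
        + (B₁ + χ (O x) * ∑[ a < suc k' ] 2)  ≡⟨ cong (λ t → + (B₁ + χ (O x) * t)) (degree-circulant w) ⟨
        + (B₁ + P)                            ≡⟨ ℤ.pos-+ B₁ P ⟩
        Tents (suc c₁) c₂ w ℤ.+ + P           ∎)
        where
        open ≡-Reasoning
        O = outside c₁ c₂
        x = toℕ w
        P = χ (O x) * degree n j w
        B₀ = bump j c₁ x + bump j (suc c₂) x
        B₁ = bump j (suc c₁) x + bump j c₂ x
        N = ∑[ a < suc k' ] (χ (O (x + j a)) + χ (O (x ∸ j a)))

      Tents-inward : ∀ s {c₁ c₂} → c₁ + s ≤ c₂ → K ≤ suc c₁ → s + c₂ + K ≤ n →
        ∀ D → D ≗ Tents c₁ (s + c₂) → ∃ λ E → Equiv n j D E × E ≗ Tents (s + c₁) c₂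
      Tents-inward zero    _ _ _ D D≗ = D , ε , D≗
      Tents-inward (suc s) {c₁} {c₂} gap K≤1+c₁ fits D D≗
        with Tents-inward s gap′ (m≤n⇒m≤1+n K≤1+c₁) (≤-trans (n≤1+n _) fits)
               (fireSet (outside c₁ (s + c₂) ∘ toℕ) D) (fireSet-Tents c₁≤s+c₂ K≤1+c₁ fits D D≗)
        where
        gap′ : suc c₁ + s ≤ c₂
        gap′ = subst (_≤ c₂) (+-suc c₁ s) gap
        c₁≤s+c₂ : c₁ ≤ s + c₂
        c₁≤s+c₂ = ≤-trans (m≤m+n c₁ (suc s)) (≤-trans gap (m≤n+m c₂ s))
      ... | E , D′~E , E≗ =
        E , fireSet-Equiv _ D ◅◅ D′~E , λ w → trans (E≗ w) (cong (λ c → Tents c c₂ w) (+-suc s c₁))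

      Tents-reach : ∀ {c₁ c₂ t} → K ≤ suc c₁ → c₂ + K ≤ n → c₁ ≤ t → t ≤ c₂ → ∀ D → D ≗ Tents c₁ c₂ →
        ∃ λ E → Equiv n j D E × ∃₂ λ c c′ → E ≗ Tents c c′ × (c ≡ t ⊎ c′ ≡ t)
      Tents-reach {c₁} K≤1+c₁ fits c₁≤t t≤c₂ D D≗ with m≤n⇒∃[o]m+o≡n c₁≤t | m≤n⇒∃[o]m+o≡n t≤c₂
      ... | a , refl | b , refl = reach (a ≤? b)
        where
        move : ∀ s c → c₁ + s ≤ c → c₁ + a + b ≡ s + c → ∃ λ E → Equiv n j D E × E ≗ Tents (s + c₁) c
        move s c gap eq = Tents-inward s gap K≤1+c₁ (subst (λ m → m + K ≤ n) eq fits) D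
          (λ w → trans (D≗ w) (cong (λ m → Tents c₁ m w) eq))
        reach : Dec (a ≤ b) →
          ∃ λ E → Equiv n j D E × ∃₂ λ c c′ → E ≗ Tents c c′ × (c ≡ c₁ + a ⊎ c′ ≡ c₁ + a)
        reach (yes a≤b)
          with move a (c₁ + b) (+-monoʳ-≤ c₁ a≤b) (trans (cong (_+ b) (+-comm c₁ a)) (+-assoc a c₁ b))
        ... | E , D~E , E≗ = E , D~E , a + c₁ , c₁ + b , E≗ , inj₁ (+-comm a c₁)
        reach (no a≰b) with move b (c₁ + a) (+-monoʳ-≤ c₁ (<⇒≤ (≰⇒> a≰b))) (+-comm (c₁ + a) b)
        ... | E , D~E , E≗ = E , D~E , b + c₁ , c₁ + a , E≗ , inj₂ refl

-- The divisor of Theorem 3.1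

module _ {k' : ℕ} (j : Fin (suc k') → ℕ) (j-increasing : ∀ a b → a <ᶠ b → j a < j b) where

  increasing⇒≤last : ∀ a → j a ≤ j (fromℕ k')
  increasing⇒≤last a with a ≟ fromℕ k'
  ... | yes refl = ≤-refl
  ... | no a≢last = <⇒≤ (j-increasing a (fromℕ k') (Fin.≤∧≢⇒< (Fin.≤fromℕ a) a≢last))

  increasing⇒injective : ∀ {a b} → j a ≡ j b → a ≡ b
  increasing⇒injective {a} {b} ja≡jb with Fin.<-cmp a b
  ... | tri< a<b _ _ = ⊥-elim (<⇒≢ (j-increasing a b a<b) ja≡jb)
  ... | tri≈ _ a≡b _ = a≡b
  ... | tri> _ _ b<a = ⊥-elim (<⇒≢ (j-increasing b a b<a) (sym ja≡jb))

module TheDivisor {n k' : ℕ} (j : Fin (suc k') → ℕ) (j-pos : ∀ a → 1 ≤ j a)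
  (j-injective : ∀ {a b} → j a ≡ j b → a ≡ b) {K₀ : ℕ} (top : Fin (suc k'))
  (j-top : j top ≡ suc K₀) (j≤K : ∀ a → j a ≤ suc K₀) (K≤n : suc K₀ ≤ n) where

  open Circulant {n} j j-pos

  K : ℕ
  K = suc K₀

  D : Divisor n
  D = theDivisor n j K

  inFirst≡ : ∀ x → inFirst K (x + 1) ≡ does (x ≤? K₀ + K₀)
  inFirst≡ x = cong₂ _∧_ (dec-true (1 ≤? x + 1) (m≤n+m 1 x))
                         (does-⇔ first⇔ (x + 1 ≤? 2 * K ∸ 1) (x ≤? K₀ + K₀))
    where
    2K∸1≡ : 2 * K ∸ 1 ≡ suc (K₀ + K₀)
    2K∸1≡ = trans (+-suc K₀ (K₀ + 0)) (cong (λ t → suc (K₀ + t)) (+-identityʳ K₀))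
    first⇔ : x + 1 ≤ 2 * K ∸ 1 ⇔ x ≤ K₀ + K₀
    first⇔ = mk⇔ (λ le → s≤s⁻¹ (subst₂ _≤_ (+-comm x 1) 2K∸1≡ le))
                 (λ le → subst₂ _≤_ (+-comm 1 x) (sym 2K∸1≡) (s≤s le))

  inSecond≡ : ∀ x → x < n → inSecond n K (x + 1) ≡ does (n ≤? x + (K + K))
  inSecond≡ x x<n = trans
    (cong₂ _∧_ (does-⇔ second⇔ (n ∸ 2 * K + 1 ≤? x + 1) (n ≤? x + (K + K)))
               (dec-true (x + 1 ≤? n) (subst (_≤ n) (+-comm 1 x) x<n)))
    (∧-identityʳ _)
    where
    2K+x≡ : 2 * K + x ≡ x + (K + K)
    2K+x≡ = trans (+-comm (2 * K) x) (cong (λ t → x + (K + t)) (+-identityʳ K))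
    second⇔ : n ∸ 2 * K + 1 ≤ x + 1 ⇔ n ≤ x + (K + K)
    second⇔ = mk⇔
      (λ le → subst (n ≤_) 2K+x≡ (Equivalence.to (∸≤⇔ n (2 * K) x) (+-cancelʳ-≤ 1 _ _ le)))
      (λ le → +-monoˡ-≤ 1 (Equivalence.from (∸≤⇔ n (2 * K) x) (subst (n ≤_) (sym 2K+x≡) le)))

  bump-mirror : ∀ {x} → x < n → bump j K (n ∸ (x + 1) + 1) ≡ bump j (n ∸ K) x
  bump-mirror {x} x<n = begin
    bump j K β                                ≡⟨ bump-∑ j K β ⟩
    ∑[ a < suc k' ] (j a ∸ ∣ K - β ∣)         ≡⟨ cong (λ t → ∑[ a < suc k' ] (j a ∸ t))
                                                    (∣-∣-mirror {x} {β} {K} {n ∸ K} x+β≡n (m+[n∸m]≡n K≤n)) ⟩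
    ∑[ a < suc k' ] (j a ∸ ∣ n ∸ K - x ∣)     ≡⟨ bump-∑ j (n ∸ K) x ⟨
    bump j (n ∸ K) x                          ∎
    where
    open ≡-Reasoning
    β = n ∸ (x + 1) + 1
    x+β≡n : x + β ≡ n
    x+β≡n = trans (regroup x (n ∸ (x + 1))) (m+[n∸m]≡n (subst (_≤ n) (+-comm 1 x) x<n))
      where
      regroup : ∀ x m → x + (m + 1) ≡ x + 1 + m
      regroup = ℕ-Solver.solve-∀

  D≡ : ∀ w → D w ≡ (if does (toℕ w ≤? K₀ + K₀) then + bump j K₀ (toℕ w)
                    else if does (n ≤? toℕ w + (K + K)) then + bump j (n ∸ K) (toℕ w) else + 0)
  D≡ w = trans (if-cong (inFirst≡ x))
    (if-cong₂ (does (x ≤? K₀ + K₀)) (cong (λ β → + bump j K β) (+-comm x 1))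
      (trans (if-cong (inSecond≡ x (Fin.toℕ<n w)))
             (if-cong-then (does (n ≤? x + (K + K))) (cong +_ (bump-mirror (Fin.toℕ<n w))))))
    where x = toℕ w

  D-Effective : Effective D
  D-Effective w = nonneg (inFirst K (toℕ w + 1)) (inSecond n K (toℕ w + 1))
    where
    nonneg : ∀ b c {m m′} → (if b then + m else if c then + m′ else + 0) ℤ.≥ + 0
    nonneg true  _     = ℤ.+≤+ z≤n
    nonneg false true  = ℤ.+≤+ z≤n
    nonneg false false = ℤ.+≤+ z≤n

  module _ (w : Fin n) where

    private
      x = toℕ w

    D-left : x ≤ K₀ + K₀ → D w ≡ + bump j K₀ x
    D-left left = trans (D≡ w) (if-cong (dec-true (x ≤? K₀ + K₀) left))

    D-right : ¬ x ≤ K₀ + K₀ → n ≤ x + (K + K) → D w ≡ + bump j (n ∸ K) x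
    D-right ¬left right = trans (D≡ w)
      (trans (if-cong (dec-false (x ≤? K₀ + K₀) ¬left)) (if-cong (dec-true (n ≤? x + (K + K)) right)))

    D-middle : ¬ x ≤ K₀ + K₀ → ¬ n ≤ x + (K + K) → D w ≡ + 0
    D-middle ¬left ¬right = trans (D≡ w)
      (trans (if-cong (dec-false (x ≤? K₀ + K₀) ¬left)) (if-cong (dec-false (n ≤? x + (K + K)) ¬right)))

    bump-left-vanish : K₀ + K₀ < x → bump j K₀ x ≡ 0
    bump-left-vanish 2K₀<x =
      bump-vanish j {c = K₀} {x} j≤K (≤∣-∣ˡ (subst (_≤ x) (sym (+-suc K₀ K₀)) 2K₀<x))

    bump-right-vanish : x + (K + K) ≤ n → bump j (n ∸ K) x ≡ 0
    bump-right-vanish fits = bump-vanish j {c = n ∸ K} {x} j≤K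
      (≤∣-∣ʳ (m+n≤o⇒m≤o∸n (x + K) (subst (_≤ n) (sym (+-assoc x K K)) fits)))

    D-chip-left : x ≤ K₀ + K₀ → + 1 ℤ.≤ D w
    D-chip-left left = subst (+ 1 ℤ.≤_) (sym (D-left left))
      (ℤ.+≤+ (bump-pos j top {K₀} {x} (subst (∣ K₀ - x ∣ <_) (sym j-top) (s≤s (∣-∣≤ left (m≤n+m K₀ x))))))

    D-chip-right : ¬ x ≤ K₀ + K₀ → n < x + (K + K) → + 1 ℤ.≤ D w
    D-chip-right ¬left right = subst (+ 1 ℤ.≤_) (sym (D-right ¬left (<⇒≤ right)))
      (ℤ.+≤+ (bump-pos j top {n ∸ K} {x} (subst (∣ n ∸ K - x ∣ <_) (sym j-top) (s≤s (∣-∣≤ x≤c+K₀ c≤x+K₀)))))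
      where
      x≤c+K₀ : x ≤ n ∸ K + K₀
      x≤c+K₀ = s≤s⁻¹ (subst (x <_) (trans (sym (m∸n+n≡m K≤n)) (+-suc (n ∸ K) K₀)) (Fin.toℕ<n w))
      c≤x+K₀ : n ∸ K ≤ x + K₀
      c≤x+K₀ = Equivalence.from (∸≤⇔ n K (x + K₀))
        (s≤s⁻¹ (subst (n <_) (regroup x K₀) right))
        where
        regroup : ∀ x k → x + (suc k + suc k) ≡ suc (suc k + (x + k))
        regroup = ℕ-Solver.solve-∀

  D≗Tents : K₀ + K₀ + (K + K) < n → D ≗ Tents K₀ (n ∸ K)
  D≗Tents separated w with toℕ w ≤? K₀ + K₀ | n ≤? toℕ w + (K + K)
  ... | yes left | _ = trans (D-left w left)
    (cong +_ (sym (trans (cong (λ t → bump j K₀ (toℕ w) + t) (bump-right-vanish w fits)) (+-identityʳ _))))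
    where
    fits : toℕ w + (K + K) ≤ n
    fits = <⇒≤ (≤-<-trans (+-monoˡ-≤ (K + K) left) separated)
  ... | no ¬left | yes right = trans (D-right w ¬left right)
    (cong +_ (sym (cong (_+ bump j (n ∸ K) (toℕ w)) (bump-left-vanish w (≰⇒> ¬left)))))
  ... | no ¬left | no ¬right = trans (D-middle w ¬left ¬right)
    (cong +_ (sym (cong₂ _+_ (bump-left-vanish w (≰⇒> ¬left)) (bump-right-vanish w (<⇒≤ (≰⇒> ¬right))))))

  chip-between : ∀ q → K₀ + K₀ < toℕ q → toℕ q + (K + K) ≤ n →
    ∃ λ E → Effective E × Equiv n j (minusPt D q) E
  chip-between q 2K₀<x fits
    with Tents-reach j≤K ≤-refl (≤-reflexive (m∸n+n≡m K≤n)) K₀≤x x≤n∸K D (D≗Tents separated)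
    where
    x = toℕ q
    j-small : ∀ a → j a + j a < n
    j-small a =
      <-≤-trans (≤-<-trans (+-mono-≤ (j≤K a) (j≤K a)) (m<n+m (K + K) (≤-<-trans z≤n 2K₀<x))) fits
    open Neighbourhoods j-injective j-small
    K₀≤x = ≤-trans (m≤m+n K₀ K₀) (<⇒≤ 2K₀<x)
    x≤n∸K = m+n≤o⇒m≤o∸n x (≤-trans (+-monoʳ-≤ x (m≤m+n K K)) fits)
    separated = <-≤-trans (+-monoˡ-< (K + K) 2K₀<x) fits
  ... | E , D~E , c , c′ , E≗ , centred with Tents-chip q E≗ (Sum.map sym sym centred)
  ...   | E≥0 , chip = positiveRank-at n j q D~E E≥0 chip

  positiveRank : PositiveRank n j D
  positiveRank q with toℕ q ≤? K₀ + K₀ | n <? toℕ q + (K + K)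
  ... | yes left | _         = positiveRank-at n j q ε D-Effective (D-chip-left q left)
  ... | no ¬left | yes right = positiveRank-at n j q ε D-Effective (D-chip-right q ¬left right)
  ... | no ¬left | no ¬right = chip-between q (≰⇒> ¬left) (≮⇒≥ ¬right)

theorem3p1 : (n k' : ℕ) (j : Fin (suc k') → ℕ) →
    (∀ a → 1 ≤ j a) →
    (∀ a b → a <ᶠ b → j a < j b) →
    (∀ a → 2 * j a ≤ n) →
    Connected n j →
    PositiveRank n j (theDivisor n j (j (fromℕ k')))
theorem3p1 n k' j j-pos j-increasing 2j≤n _ with m≤n⇒∃[o]m+o≡n (j-pos (fromℕ k'))
... | K₀ , K≡ = subst (λ K → PositiveRank n j (theDivisor n j K)) K≡
  (TheDivisor.positiveRank j j-pos (increasing⇒injective j j-increasing) (fromℕ k') (sym K≡)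
    (λ a → subst (j a ≤_) (sym K≡) (increasing⇒≤last j j-increasing a))
    (subst (_≤ n) (sym K≡) (≤-trans (m≤m+n _ _) (2j≤n (fromℕ k')))))
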